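{- Let $L$ be a hitomezashi loop. If $a$ is a longitude at which $L$ has at least one horizontal stitch, then the horizontal stitches of $L$ at longitude $a$ are either all indents, all outdents, or all nondents. The analogous statement holds for vertical stitches at a fixed latitude.
   Context: A hitomezashi pattern is determined by labels $\epsilon_i\in\{0,1\}$ for every integer $i$ and $\eta_j\in\{0,1\}$ for every integer $j$. Its vertical stitches are the unit segments from $(i,j)$ to $(i,j+1)$ for all integers $i,j$ with $j\equiv \epsilon_i \pmod 2$; its horizontal stitches are the unit segments from $(i,j)$ to $(i+1,j)$ for all integers $i,j$ with $i\equiv \eta_j\pmod 2$. A hitomezashi loop is a simple closed curve that is a union of stitches of some hitomezashi pattern. The longitude (resp. latitude) of a unit segment is the $x$-coordinate (resp. $y$-coordinate) of its midpoint. For a horizontal stitch $s$ of $L$, let $s_1,s_2$ be the two vertical stitches of $L$ sharing an endpoint with $s$. If $s_1,s_2$ have the same latitude and the unit cell between them lies in the exterior of $L$, $s$ is an indent; if they have the same latitude and that cell lies in the interior of $L$, $s$ is an outdent; if they have different latitudes, $s$ is a nondent. The same definitions apply to vertical stitches with the roles of horizontal and vertical exchanged. -}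

module Defs where

open import Data.Nat as ℕ using (ℕ; _≤_)
open import Data.Integer using (ℤ; +_; _+_; _-_; _<_; 1ℤ)
open import Data.Integer.Properties using (_≟_; _<?_)
open import Data.Integer.DivMod using (_%ℕ_)
open import Data.Integer.Divisibility using (_∣_)
open import Data.Fin using (Fin; toℕ)
open import Data.Product using (_×_; _,_; proj₁; proj₂; ∃; ∃-syntax)
open import Data.Sum using (_⊎_)
open import Data.List using (List; map; upTo)
open import Data.Nat.ListAction using (sum)
open import Relation.Nullary using (¬_; Dec; does)
open import Relation.Nullary.Decidable using (_×-dec_; _⊎-dec_)
open import Relation.Binary.PropositionalEquality using (_≡_)
open import Data.Bool using (Bool; if_then_else_)

Point : Set
Point = ℤ × ℤ

VSeg : ℤ → ℤ → Point → Point → Set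
VSeg i j p q = (p ≡ (i , j) × q ≡ (i , j + 1ℤ)) ⊎ (p ≡ (i , j + 1ℤ) × q ≡ (i , j))

HSeg : ℤ → ℤ → Point → Point → Set
HSeg i j p q = (p ≡ (i , j) × q ≡ (i + 1ℤ , j)) ⊎ (p ≡ (i + 1ℤ , j) × q ≡ (i , j))

UnitStep : Point → Point → Set
UnitStep p q = (∃[ i ] ∃[ j ] VSeg i j p q) ⊎ (∃[ i ] ∃[ j ] HSeg i j p q)

-- A simple closed lattice curve made of unit segments, given as a
-- cyclic sequence of n ≥ 3 pairwise distinct lattice points
-- v 0 , v 1 , … , v (n-1) (indices taken modulo n); its edges are the
-- unit segments from v k to v (k+1).
record Loop : Set where
  field
    n        : ℕ
    3≤n      : 3 ≤ n
    v        : ℤ → Point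
    periodic : ∀ k → v (k + + n) ≡ v k
    simple   : ∀ a b → v a ≡ v b → (+ n) ∣ (a - b)
    unitStep : ∀ k → UnitStep (v k) (v (k + 1ℤ))
open Loop public

PatV : (ℤ → Fin 2) → ℤ → ℤ → Set
PatV ε i j = j %ℕ 2 ≡ toℕ (ε i)

PatH : (ℤ → Fin 2) → ℤ → ℤ → Set
PatH η i j = i %ℕ 2 ≡ toℕ (η j)

IsStitch : (ℤ → Fin 2) → (ℤ → Fin 2) → Point → Point → Set
IsStitch ε η p q =
  (∃[ i ] ∃[ j ] (VSeg i j p q × PatV ε i j)) ⊎
  (∃[ i ] ∃[ j ] (HSeg i j p q × PatH η i j))

IsHitomezashiLoop : Loop → Set
IsHitomezashiLoop L =
  ∃[ ε ] ∃[ η ] (∀ k → IsStitch ε η (v L k) (v L (k + 1ℤ)))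

-- The vertical unit segment (i , j)–(i , j+1) is a stitch (edge) of L.
-- Its latitude is j + 1/2.
VStitch : Loop → ℤ → ℤ → Set
VStitch L i j = ∃[ k ] VSeg i j (v L k) (v L (k + 1ℤ))

-- The horizontal unit segment (i , j)–(i+1 , j) is a stitch of L.
-- Its longitude is i + 1/2.
HStitch : Loop → ℤ → ℤ → Set
HStitch L i j = ∃[ k ] HSeg i j (v L k) (v L (k + 1ℤ))

-- Interior of L (ray casting / even–odd rule): the unit cell
-- [i , i+1] × [j , j+1] lies in the interior of L iff the horizontal ray
-- from its centre towards +∞ crosses an odd number of edges of L, i.e.
-- the number of vertical stitches (x , j)–(x , j+1) of L with x > i is odd.
crosses? : ℤ → ℤ → Point → Point → Bool
crosses? i j (px , py) (qx , qy) = does (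
  (px ≟ qx) ×-dec ((i <? px) ×-dec
    (((py ≟ j) ×-dec (qy ≟ j + 1ℤ)) ⊎-dec ((py ≟ j + 1ℤ) ×-dec (qy ≟ j)))))

crossCount : Loop → ℤ → ℤ → ℕ
crossCount L i j =
  sum (map (λ k → if (crosses? i j (v L (+ k)) (v L (+ k + 1ℤ))) then 1 else 0)
           (upTo (n L)))

InteriorCell : Loop → ℤ → ℤ → Set
InteriorCell L i j = crossCount L i j ℕ.% 2 ≡ 1

ExteriorCell : Loop → ℤ → ℤ → Set
ExteriorCell L i j = ¬ InteriorCell L i j

-- j' is one of the two latitudes j - 1 , j  (i.e. the vertical segment
-- (x , j')–(x , j'+1) contains the point (x , j)).
Near : ℤ → ℤ → Set
Near j j' = (j' ≡ j) ⊎ (j' ≡ j - 1ℤ)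

-- Horizontal stitch s = (i , j)–(i+1 , j) of L.  s₁ = (i , j₁)–(i , j₁+1)
-- and s₂ = (i+1 , j₂)–(i+1 , j₂+1) are the vertical stitches of L sharing
-- an endpoint with s.  When j₁ = j₂ the cell between them is
-- [i , i+1] × [j₁ , j₁+1].
HIndent : Loop → ℤ → ℤ → Set
HIndent L i j = ∃[ j₁ ] (Near j j₁ × VStitch L i j₁ × VStitch L (i + 1ℤ) j₁
                         × ExteriorCell L i j₁)

HOutdent : Loop → ℤ → ℤ → Set
HOutdent L i j = ∃[ j₁ ] (Near j j₁ × VStitch L i j₁ × VStitch L (i + 1ℤ) j₁
                          × InteriorCell L i j₁)

HNondent : Loop → ℤ → ℤ → Set
HNondent L i j = ∃[ j₁ ] ∃[ j₂ ] (Near j j₁ × Near j j₂ × VStitch L i j₁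
                                  × VStitch L (i + 1ℤ) j₂ × ¬ (j₁ ≡ j₂))

-- Vertical stitch s = (i , j)–(i , j+1) of L.  s₁ = (i₁ , j)–(i₁+1 , j)
-- and s₂ = (i₂ , j+1)–(i₂+1 , j+1) are the horizontal stitches of L
-- sharing an endpoint with s.  When i₁ = i₂ the cell between them is
-- [i₁ , i₁+1] × [j , j+1].
VIndent : Loop → ℤ → ℤ → Set
VIndent L i j = ∃[ i₁ ] (Near i i₁ × HStitch L i₁ j × HStitch L i₁ (j + 1ℤ)
                         × ExteriorCell L i₁ j)

VOutdent : Loop → ℤ → ℤ → Set
VOutdent L i j = ∃[ i₁ ] (Near i i₁ × HStitch L i₁ j × HStitch L i₁ (j + 1ℤ)
                          × InteriorCell L i₁ j)

VNondent : Loop → ℤ → ℤ → Set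
VNondent L i j = ∃[ i₁ ] ∃[ i₂ ] (Near i i₁ × Near i i₂ × HStitch L i₁ j
                                  × HStitch L i₂ (j + 1ℤ) × ¬ (i₁ ≡ i₂))

{-# OPTIONS --safe #-}
module Submission where

-- The parity of the number of edges of L that the ray from a cell
-- crosses changes between two adjacent cells only across an edge of L.  In a hitomezashi pattern
-- exactly one vertical and one horizontal segment at each lattice point is a stitch, so L turns
-- at every vertex, and the three cells at a vertex outside the turn are joined across unstitched
-- segments, hence are all interior or all exterior.  Walking along L, it follows that one rule
-- decides from its checkerboard colour alone whether a cell beside L is interior.  At longitude a
-- the vertical stitches in the columns a and a + 1 have latitudes of fixed parities ε a and
-- ε (a + 1), so the two walls of a horizontal stitch there are aligned for every such stitch or
-- for none, and when they are aligned the cell between them lies beside L with a colour fixed by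
-- a and ε a, hence has a fixed status.

open import Defs
open import Data.Integer using (ℤ)
open import Data.Product using (_×_; ∃-syntax; _,_; proj₁; proj₂; Σ-syntax)
open import Data.Sum using (_⊎_; inj₁; inj₂)

import Algebra.Properties.CommutativeSemigroup as CommutativeSemigroupProperties
open import Data.Bool.Base using (Bool; true; false; _∧_; if_then_else_)
open import Data.Bool.Properties using (∧-zeroʳ; ∧-idem; ∧-comm; ∨-identityʳ)
open import Data.Empty using (⊥; ⊥-elim)
open import Data.Fin.Base using (Fin; toℕ)
open import Data.Integer.Base as ℤ
  using (+_; -[1+_]; _+_; _-_; _<_; _≤_; 0ℤ; 1ℤ; _%ℕ_; _⊓_)
open import Data.Integer.Properties as ℤₚ using (_≟_; _<?_)
open import Data.Integer.Tactic.RingSolver using (solve-∀)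
open import Data.List.Base using (map; upTo; _++_; [_])
open import Data.List.Properties using (map-cong; map-++; upTo-∷ʳ)
open import Data.Nat.Base as ℕ using (ℕ; zero; suc; parity; _%_; s≤s)
open import Data.Nat.DivMod using (m%n<n)
import Data.Nat.Divisibility as ℕ∣
open import Data.Nat.ListAction using (sum)
open import Data.Nat.ListAction.Properties using (sum-++)
import Data.Nat.Properties as ℕₚ
open import Data.Parity.Base as ℙ using (Parity; 0ℙ; 1ℙ; _⁻¹)
import Data.Parity.Properties as ℙₚ
import Data.Product as Prod
import Data.Sum as Sum
open import Function.Base using (_∘_; case_of_)
open import Function.Bundles using (_⇔_; mk⇔; module Equivalence)
open Equivalence using (to; from)
import Function.Properties.Equivalence as ⇔
open import Relation.Binary.PropositionalEquality
  using (_≡_; _≢_; refl; sym; trans; cong; cong₂; subst; subst₂; module ≡-Reasoning)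
open import Relation.Nullary using (¬_; yes; no; does)
open import Relation.Nullary.Decidable using (dec-true; dec-false; does-⇔)

parityℤ : ℤ → Parity
parityℤ (+ n)    = parity n
parityℤ -[1+ n ] = parity (suc n)

parityℤ-pred : ∀ x → parityℤ (x - 1ℤ) ≡ parityℤ x ⁻¹
parityℤ-pred (+ zero)  = refl
parityℤ-pred (+ suc n) = sym (ℙₚ.suc-homo-⁻¹ n)
parityℤ-pred -[1+ n ]  = trans (cong parity (ℕₚ.+-identityʳ n)) (sym (ℙₚ.suc-homo-⁻¹ n))

parity-%2 : ∀ n → parity (n % 2) ≡ parity n
parity-%2 0             = refl
parity-%2 1             = refl
parity-%2 (suc (suc n)) = parity-%2 n

parity-%ℕ2 : ∀ x → parity (x %ℕ 2) ≡ parityℤ x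
parity-%ℕ2 (+ n)    = parity-%2 n
-- On negative integers _%ℕ_ is computed by cases on suc n % 2.
parity-%ℕ2 -[1+ n ] with suc n % 2 | parity-%2 (suc n) | m%n<n (suc n) 2
... | 0           | e | _ = e
... | 1           | e | _ = e
... | suc (suc _) | _ | s≤s (s≤s ())

%2≡1⇔parity≡1ℙ : ∀ n → n % 2 ≡ 1 ⇔ parity n ≡ 1ℙ
%2≡1⇔parity≡1ℙ 0             = mk⇔ (λ ()) (λ ())
%2≡1⇔parity≡1ℙ 1             = mk⇔ (λ _ → refl) (λ _ → refl)
%2≡1⇔parity≡1ℙ (suc (suc n)) = %2≡1⇔parity≡1ℙ n

%ℕ2-alternates : ∀ {z t} → z %ℕ 2 ≡ t → ¬ (z - 1ℤ) %ℕ 2 ≡ t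
%ℕ2-alternates {z} e e' = ℙₚ.p≢p⁻¹ (parityℤ z) (begin
  parityℤ z              ≡⟨ parity-%ℕ2 z ⟨
  parity (z %ℕ 2)        ≡⟨ cong parity (trans e (sym e')) ⟩
  parity ((z - 1ℤ) %ℕ 2) ≡⟨ parity-%ℕ2 (z - 1ℤ) ⟩
  parityℤ (z - 1ℤ)       ≡⟨ parityℤ-pred z ⟩
  parityℤ z ⁻¹           ∎)
  where open ≡-Reasoning

near-parityℤ-injective : ∀ {t j j'} → Near t j → Near t j' → parityℤ j ≡ parityℤ j' → j ≡ j'
near-parityℤ-injective     (inj₁ refl) (inj₁ refl) _ = refl
near-parityℤ-injective {t} (inj₁ refl) (inj₂ refl) e =
  ⊥-elim (ℙₚ.p≢p⁻¹ (parityℤ t) (trans e (parityℤ-pred t)))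
near-parityℤ-injective {t} (inj₂ refl) (inj₁ refl) e =
  ⊥-elim (ℙₚ.p≢p⁻¹ (parityℤ t) (trans (sym e) (parityℤ-pred t)))
near-parityℤ-injective     (inj₂ refl) (inj₂ refl) _ = refl

⁻¹-+ : ∀ p q → p ⁻¹ ℙ.+ q ≡ (p ℙ.+ q) ⁻¹
⁻¹-+ 0ℙ q = refl
⁻¹-+ 1ℙ q = sym (ℙₚ.⁻¹-involutive q)

+-⁻¹ : ∀ p q → p ℙ.+ q ⁻¹ ≡ (p ℙ.+ q) ⁻¹
+-⁻¹ 0ℙ q = refl
+-⁻¹ 1ℙ q = refl

interpolate : ∀ p (a b : Parity) → Σ[ f ∈ (Parity → Parity) ] f p ≡ a × f (p ⁻¹) ≡ b
interpolate 0ℙ a b = (λ { 0ℙ → a ; 1ℙ → b }) , refl , refl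
interpolate 1ℙ a b = (λ { 0ℙ → b ; 1ℙ → a }) , refl , refl

Σℙ : (ℕ → Parity) → ℕ → Parity
Σℙ f zero    = 0ℙ
Σℙ f (suc n) = Σℙ f n ℙ.+ f n

parity-sum-upTo : ∀ (f : ℕ → ℕ) n → parity (sum (map f (upTo n))) ≡ Σℙ (parity ∘ f) n
parity-sum-upTo f zero    = refl
parity-sum-upTo f (suc n) = begin
  parity (sum (map f (upTo (suc n))))
    ≡⟨ cong (parity ∘ sum ∘ map f) (upTo-∷ʳ n) ⟨
  parity (sum (map f (upTo n ++ [ n ])))
    ≡⟨ cong (parity ∘ sum) (map-++ f (upTo n) [ n ]) ⟩
  parity (sum (map f (upTo n) ++ [ f n ]))
    ≡⟨ cong parity (sum-++ (map f (upTo n)) [ f n ]) ⟩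
  parity (sum (map f (upTo n)) ℕ.+ (f n ℕ.+ 0))
    ≡⟨ ℙₚ.+-homo-+ (sum (map f (upTo n))) _ ⟩
  parity (sum (map f (upTo n))) ℙ.+ parity (f n ℕ.+ 0)
    ≡⟨ cong₂ ℙ._+_ (parity-sum-upTo f n) (cong parity (ℕₚ.+-identityʳ (f n))) ⟩
  Σℙ (parity ∘ f) n ℙ.+ parity (f n)                  ∎
  where open ≡-Reasoning

Σℙ-telescoping : ∀ {f g F : ℕ → Parity} → (∀ k → f k ℙ.+ g k ≡ F k ℙ.+ F (suc k)) →
                 ∀ n → Σℙ f n ℙ.+ Σℙ g n ≡ F 0 ℙ.+ F n
Σℙ-telescoping {F = F} step zero        = sym (ℙₚ.p+p≡0ℙ (F 0))
Σℙ-telescoping {f} {g} {F} step (suc n) = begin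
  (Σℙ f n ℙ.+ f n) ℙ.+ (Σℙ g n ℙ.+ g n) ≡⟨ interchange (Σℙ f n) (f n) (Σℙ g n) (g n) ⟩
  (Σℙ f n ℙ.+ Σℙ g n) ℙ.+ (f n ℙ.+ g n) ≡⟨ cong₂ ℙ._+_ (Σℙ-telescoping {F = F} step n) (step n) ⟩
  (F 0 ℙ.+ F n) ℙ.+ (F n ℙ.+ F (suc n)) ≡⟨ ℙₚ.+-assoc (F 0) (F n) _ ⟩
  F 0 ℙ.+ (F n ℙ.+ (F n ℙ.+ F (suc n))) ≡⟨ cong (F 0 ℙ.+_) (ℙₚ.+-assoc (F n) (F n) _) ⟨
  F 0 ℙ.+ ((F n ℙ.+ F n) ℙ.+ F (suc n))
    ≡⟨ cong (λ p → F 0 ℙ.+ (p ℙ.+ F (suc n))) (ℙₚ.p+p≡0ℙ (F n)) ⟩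
  F 0 ℙ.+ F (suc n)                     ∎
  where
  open ≡-Reasoning
  open CommutativeSemigroupProperties ℙₚ.+-commutativeSemigroup using (interchange)

+1-1 : ∀ x → x + 1ℤ - 1ℤ ≡ x
+1-1 = solve-∀

-1+1 : ∀ x → x - 1ℤ + 1ℤ ≡ x
-1+1 = solve-∀

+k+1≡+suc : ∀ k → + k + 1ℤ ≡ + suc k
+k+1≡+suc k = cong +_ (ℕₚ.+-comm k 1)

x≢x+1 : ∀ {x} → x ≢ x + 1ℤ
x≢x+1 {x} e = ℤₚ.i≢suc[i] (trans e (ℤₚ.+-comm x 1ℤ))

x≤x+1 : ∀ x → x ≤ x + 1ℤ
x≤x+1 x = subst (x ≤_) (ℤₚ.+-comm 1ℤ x) (ℤₚ.i≤suc[i] x)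

x+1+1≢x : ∀ {x} → x + 1ℤ + 1ℤ ≢ x
x+1+1≢x {x} e =
  ℤₚ.<-irrefl (sym e) (ℤₚ.<-≤-trans (ℤₚ.≤∧≢⇒< (x≤x+1 x) x≢x+1) (x≤x+1 (x + 1ℤ)))

+1-injective : ∀ {x y} → x + 1ℤ ≡ y + 1ℤ → x ≡ y
+1-injective {x} {y} e = trans (sym (+1-1 x)) (trans (cong (_- 1ℤ) e) (+1-1 y))

+1≡⇔≡-1 : ∀ {x y} → x + 1ℤ ≡ y ⇔ x ≡ y - 1ℤ
+1≡⇔≡-1 {x} {y} = mk⇔ (λ e → trans (sym (+1-1 x)) (cong (_- 1ℤ) e))
                      (λ e → trans (cong (_+ 1ℤ) e) (-1+1 y))

-1<⇔≤ : ∀ {x i} → x - 1ℤ < i ⇔ x ≤ i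
-1<⇔≤ {x} {i} = mk⇔ (λ lt → subst (_≤ i) e (ℤₚ.i<j⇒suc[i]≤j lt))
                    (λ le → ℤₚ.suc[i]≤j⇒i<j (subst (_≤ i) (sym e) le))
  where
  e : ℤ.suc (x - 1ℤ) ≡ x
  e = trans (ℤₚ.+-comm 1ℤ (x - 1ℤ)) (-1+1 x)

<+1⇔≤ : ∀ {x i} → x < i + 1ℤ ⇔ x ≤ i
<+1⇔≤ {x} {i} = mk⇔ (λ lt → subst (x ≤_) e (ℤₚ.i<j⇒i≤pred[j] lt))
                    (λ le → ℤₚ.i≤pred[j]⇒i<j (subst (x ≤_) (sym e) le))
  where
  e : ℤ.pred (i + 1ℤ) ≡ i
  e = trans (ℤₚ.+-comm ℤ.-1ℤ (i + 1ℤ)) (+1-1 i)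

≤⇔< : ∀ {x i} → i ≢ x → x ≤ i ⇔ x < i
≤⇔< i≢x = mk⇔ (λ le → ℤₚ.≤∧≢⇒< le (i≢x ∘ sym)) ℤₚ.<⇒≤

ℤ-induction : ∀ (P : ℤ → Set) → (∀ k → P k ⇔ P (k + 1ℤ)) → P 0ℤ → ∀ k → P k
ℤ-induction P step base (+ zero)     = base
ℤ-induction P step base (+ suc n)    =
  subst P (+k+1≡+suc n) (to (step (+ n)) (ℤ-induction P step base (+ n)))
ℤ-induction P step base -[1+ zero ]  = from (step -[1+ 0 ]) base
ℤ-induction P step base -[1+ suc n ] =
  from (step -[1+ suc n ]) (ℤ-induction P step base -[1+ n ])

-- Unit segments

data Segment : Set where
  vert horiz : ℤ → ℤ → Segment

Joins : Segment → Point → Point → Set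
Joins (vert i j)  = VSeg i j
Joins (horiz i j) = HSeg i j

joins-sym : ∀ {s p q} → Joins s p q → Joins s q p
joins-sym {vert _ _}  = Sum.swap ∘ Sum.map Prod.swap Prod.swap
joins-sym {horiz _ _} = Sum.swap ∘ Sum.map Prod.swap Prod.swap

segmentBetween : Point → Point → Segment
segmentBetween (px , py) (qx , qy) =
  if does (px ≟ qx) then vert px (py ⊓ qy) else horiz (px ⊓ qx) py

joins⇒≡segmentBetween : ∀ {s p q} → Joins s p q → s ≡ segmentBetween p q
joins⇒≡segmentBetween {vert i j} (inj₁ (refl , refl)) rewrite dec-true (i ≟ i) refl =
  cong (vert i) (sym (ℤₚ.i≤j⇒i⊓j≡i (x≤x+1 j)))
joins⇒≡segmentBetween {vert i j} (inj₂ (refl , refl)) rewrite dec-true (i ≟ i) refl =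
  cong (vert i) (sym (ℤₚ.i≥j⇒i⊓j≡j (x≤x+1 j)))
joins⇒≡segmentBetween {horiz i j} (inj₁ (refl , refl)) rewrite dec-false (i ≟ i + 1ℤ) x≢x+1 =
  cong (λ x → horiz x j) (sym (ℤₚ.i≤j⇒i⊓j≡i (x≤x+1 i)))
joins⇒≡segmentBetween {horiz i j} (inj₂ (refl , refl))
  rewrite dec-false (i + 1ℤ ≟ i) (x≢x+1 ∘ sym) =
  cong (λ x → horiz x j) (sym (ℤₚ.i≥j⇒i⊓j≡j (x≤x+1 i)))

joins-unique : ∀ {s s' p q} → Joins s p q → Joins s' p q → s ≡ s'
joins-unique J J' = trans (joins⇒≡segmentBetween J) (sym (joins⇒≡segmentBetween J'))

data Axis : Set where
  vertical horizontal : Axis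

data Dir : Axis → Set where
  up down    : Dir vertical
  left right : Dir horizontal

segmentAt : ∀ {a} → Point → Dir a → Segment
segmentAt (x , y) up    = vert x y
segmentAt (x , y) down  = vert x (y - 1ℤ)
segmentAt (x , y) left  = horiz (x - 1ℤ) y
segmentAt (x , y) right = horiz x y

neighbour : ∀ {a} → Point → Dir a → Point
neighbour (x , y) up    = (x , y + 1ℤ)
neighbour (x , y) down  = (x , y - 1ℤ)
neighbour (x , y) left  = (x - 1ℤ , y)
neighbour (x , y) right = (x + 1ℤ , y)

joins⇒segmentAt : ∀ {s p q} → Joins s p q →
                  ∃[ a ] Σ[ d ∈ Dir a ] s ≡ segmentAt q d × p ≡ neighbour q d
joins⇒segmentAt {vert i j} (inj₁ (refl , refl)) =
  vertical , down , cong (vert i) (sym (+1-1 j)) , cong (i ,_) (sym (+1-1 j))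
joins⇒segmentAt {vert i j} (inj₂ (refl , refl)) = vertical , up , refl , refl
joins⇒segmentAt {horiz i j} (inj₁ (refl , refl)) =
  horizontal , left , cong (λ x → horiz x j) (sym (+1-1 i)) , cong (_, j) (sym (+1-1 i))
joins⇒segmentAt {horiz i j} (inj₂ (refl , refl)) = horizontal , right , refl , refl

-- A cell is named by its lower left corner; cell⁻ s and cell⁺ s are the cells on either side of s.
cell⁻ cell⁺ : Segment → Point
cell⁻ (vert i j)  = (i - 1ℤ , j)
cell⁻ (horiz i j) = (i , j - 1ℤ)
cell⁺ (vert i j)  = (i , j)
cell⁺ (horiz i j) = (i , j)

colour : Point → Parity
colour (x , y) = parityℤ x ℙ.+ parityℤ y

colour-cell⁻ : ∀ s → colour (cell⁻ s) ≡ colour (cell⁺ s) ⁻¹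
colour-cell⁻ (vert x y)  =
  trans (cong (ℙ._+ parityℤ y) (parityℤ-pred x)) (⁻¹-+ (parityℤ x) (parityℤ y))
colour-cell⁻ (horiz x y) =
  trans (cong (parityℤ x ℙ.+_) (parityℤ-pred y)) (+-⁻¹ (parityℤ x) (parityℤ y))

colour-diagonal : ∀ x y → colour (x - 1ℤ , y - 1ℤ) ≡ colour (x , y)
colour-diagonal x y = trans (colour-cell⁻ (vert x (y - 1ℤ)))
  (trans (cong _⁻¹ (colour-cell⁻ (horiz x y))) (ℙₚ.⁻¹-involutive (colour (x , y))))

colour-antidiagonal : ∀ x y → colour (x - 1ℤ , y) ≡ colour (x , y - 1ℤ)
colour-antidiagonal x y = trans (colour-cell⁻ (vert x y)) (sym (colour-cell⁻ (horiz x y)))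

-- Crossing parity

IsEdge : Loop → Segment → Set
IsEdge L s = ∃[ k ] Joins s (v L k) (v L (k + 1ℤ))

edge : Loop → ℤ → Segment
edge L k with unitStep L k
... | inj₁ (i , j , _) = vert i j
... | inj₂ (i , j , _) = horiz i j

edge-joins : ∀ L k → Joins (edge L k) (v L k) (v L (k + 1ℤ))
edge-joins L k with unitStep L k
... | inj₁ (_ , _ , J) = J
... | inj₂ (_ , _ , J) = J

non-edge-≢ : ∀ L {s} → ¬ IsEdge L s → ∀ k → edge L k ≢ s
non-edge-≢ L ¬e k refl = ¬e (k , edge-joins L k)

no-backtrack : ∀ L k → v L k ≢ v L (k + 1ℤ + 1ℤ)
no-backtrack L k e =
  ℕₚ.<⇒≱ (3≤n L) (ℕ∣.∣⇒≤ (subst (λ z → n L ℕ∣.∣ ℤ.∣ z ∣) (two-back k) (simple L k _ e)))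
  where
  two-back : ∀ k → k - (k + 1ℤ + 1ℤ) ≡ ℤ.- (+ 2)
  two-back = solve-∀

inside : Loop → Point → Parity
inside L (x , y) = parity (crossCount L x y)

interior⇔inside≡1ℙ : ∀ L {x y} → InteriorCell L x y ⇔ inside L (x , y) ≡ 1ℙ
interior⇔inside≡1ℙ L {x} {y} = %2≡1⇔parity≡1ℙ (crossCount L x y)

j+1≟y+1 : ∀ j y → does (j + 1ℤ ≟ y + 1ℤ) ≡ does (j ≟ y)
j+1≟y+1 j y = does-⇔ (mk⇔ +1-injective (cong (_+ 1ℤ))) (j + 1ℤ ≟ y + 1ℤ) (j ≟ y)

j≟y+1∧j+1≟y≡false : ∀ j y → does (j ≟ y + 1ℤ) ∧ does (j + 1ℤ ≟ y) ≡ false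
j≟y+1∧j+1≟y≡false j y with j ≟ y + 1ℤ
... | yes refl = dec-false (y + 1ℤ + 1ℤ ≟ y) x+1+1≢x
... | no _     = refl

crosses?-vert : ∀ {i j x y p q} → VSeg i j p q →
                crosses? x y p q ≡ does (x <? i) ∧ does (j ≟ y)
crosses?-vert {i} {j} {x} {y} (inj₁ (refl , refl))
  rewrite dec-true (i ≟ i) refl | j+1≟y+1 j y | j≟y+1∧j+1≟y≡false j y =
  cong (does (x <? i) ∧_) (trans (∨-identityʳ _) (∧-idem _))
crosses?-vert {i} {j} {x} {y} (inj₂ (refl , refl))
  rewrite dec-true (i ≟ i) refl | j+1≟y+1 j y
        | ∧-comm (does (j + 1ℤ ≟ y)) (does (j ≟ y + 1ℤ)) | j≟y+1∧j+1≟y≡false j y =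
  cong (does (x <? i) ∧_) (∧-idem _)

crosses?-horiz : ∀ {i j x y p q} → HSeg i j p q → crosses? x y p q ≡ false
crosses?-horiz {i} (inj₁ (refl , refl)) rewrite dec-false (i ≟ i + 1ℤ) x≢x+1 = refl
crosses?-horiz {i} (inj₂ (refl , refl)) rewrite dec-false (i + 1ℤ ≟ i) (x≢x+1 ∘ sym) = refl

crosses?-across-vert : ∀ {s p q x y} → Joins s p q → s ≢ vert x y →
                       crosses? (x - 1ℤ) y p q ≡ crosses? x y p q
crosses?-across-vert {vert i j} {x = x} {y} J s≢
  rewrite crosses?-vert {x = x - 1ℤ} {y = y} J | crosses?-vert {x = x} {y = y} J with j ≟ y
... | yes refl = cong (_∧ true) (does-⇔ (⇔.trans -1<⇔≤ (≤⇔< i≢x)) (x - 1ℤ <? i) (x <? i))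
  where
  i≢x : i ≢ x
  i≢x i≡x = s≢ (cong₂ vert i≡x refl)
... | no _     = trans (∧-zeroʳ _) (sym (∧-zeroʳ _))
crosses?-across-vert {horiz _ _} {x = x} {y} J _ =
  trans (crosses?-horiz {x = x - 1ℤ} {y = y} J) (sym (crosses?-horiz {x = x} {y = y} J))

crossCount-across-vert : ∀ L {x y} → ¬ IsEdge L (vert x y) →
                         crossCount L (x - 1ℤ) y ≡ crossCount L x y
crossCount-across-vert L {x} {y} ¬e =
  cong sum (map-cong (λ k → cong (λ b → if b then 1 else 0) (same k)) (upTo (n L)))
  where
  same : ∀ k → crosses? (x - 1ℤ) y (v L (+ k)) (v L (+ k + 1ℤ))
             ≡ crosses? x y (v L (+ k)) (v L (+ k + 1ℤ))
  same k = crosses?-across-vert (edge-joins L (+ k)) (non-edge-≢ L ¬e (+ k))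

bit : Bool → Parity
bit b = parity (if b then 1 else 0)

rowMark : ℤ → ℤ → Point → Parity
rowMark x y (px , py) = bit (does (x <? px) ∧ does (py ≟ y))

rowMark-step : ∀ {i j x y} → horiz i j ≢ horiz x y →
               rowMark x y (i , j) ≡ rowMark x y (i + 1ℤ , j)
rowMark-step {i} {j} {x} {y} s≢ with j ≟ y
... | yes refl = cong (λ b → bit (b ∧ true))
  (does-⇔ (⇔.trans (⇔.sym (≤⇔< i≢x)) (⇔.sym <+1⇔≤)) (x <? i) (x <? i + 1ℤ))
  where
  i≢x : i ≢ x
  i≢x i≡x = s≢ (cong₂ horiz i≡x refl)
... | no _     =
  cong bit (trans (∧-zeroʳ (does (x <? i))) (sym (∧-zeroʳ (does (x <? i + 1ℤ)))))

crossings≡rowMarks : ∀ {s p q x y} → Joins s p q → s ≢ horiz x y →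
  bit (crosses? x (y - 1ℤ) p q) ℙ.+ bit (crosses? x y p q) ≡ rowMark x y p ℙ.+ rowMark x y q
crossings≡rowMarks {vert i j} {x = x} {y} J@(inj₁ (refl , refl)) _
  rewrite crosses?-vert {x = x} {y = y - 1ℤ} J | crosses?-vert {x = x} {y = y} J
        | does-⇔ +1≡⇔≡-1 (j + 1ℤ ≟ y) (j ≟ y - 1ℤ) =
  ℙₚ.+-comm (bit (does (x <? i) ∧ does (j ≟ y - 1ℤ))) (bit (does (x <? i) ∧ does (j ≟ y)))
crossings≡rowMarks {vert i j} {x = x} {y} J@(inj₂ (refl , refl)) _
  rewrite crosses?-vert {x = x} {y = y - 1ℤ} J | crosses?-vert {x = x} {y = y} J
        | does-⇔ +1≡⇔≡-1 (j + 1ℤ ≟ y) (j ≟ y - 1ℤ) = refl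
crossings≡rowMarks {horiz i j} {x = x} {y} J@(inj₁ (refl , refl)) s≢
  rewrite crosses?-horiz {x = x} {y = y - 1ℤ} J | crosses?-horiz {x = x} {y = y} J =
  sym (trans (cong (ℙ._+ rowMark x y (i + 1ℤ , j)) (rowMark-step s≢))
             (ℙₚ.p+p≡0ℙ (rowMark x y (i + 1ℤ , j))))
crossings≡rowMarks {horiz i j} {x = x} {y} J@(inj₂ (refl , refl)) s≢
  rewrite crosses?-horiz {x = x} {y = y - 1ℤ} J | crosses?-horiz {x = x} {y = y} J =
  sym (trans (cong (rowMark x y (i + 1ℤ , j) ℙ.+_) (rowMark-step s≢))
             (ℙₚ.p+p≡0ℙ (rowMark x y (i + 1ℤ , j))))

-- Per edge, the two rays at heights y ∓ ½ are crossed an odd number of times in total exactly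
-- when one endpoint of the edge lies on the line at height y to the right of x; around the
-- closed loop these endpoint terms telescope away.
inside-across-horiz : ∀ L {x y} → ¬ IsEdge L (horiz x y) →
                      inside L (x , y - 1ℤ) ≡ inside L (x , y)
inside-across-horiz L {x} {y} ¬e =
  ℙₚ.+-cancelʳ-≡ (inside L (x , y)) _ _ (trans cancels (sym (ℙₚ.p+p≡0ℙ (inside L (x , y)))))
  where
  mark : ℕ → Parity
  mark k = rowMark x y (v L (+ k))
  crossing : ℤ → ℕ → Parity
  crossing h k = bit (crosses? x h (v L (+ k)) (v L (+ k + 1ℤ)))
  step : ∀ k → crossing (y - 1ℤ) k ℙ.+ crossing y k ≡ mark k ℙ.+ mark (suc k)
  step k = trans (crossings≡rowMarks (edge-joins L (+ k)) (non-edge-≢ L ¬e (+ k)))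
                 (cong (λ z → mark k ℙ.+ rowMark x y (v L z)) (+k+1≡+suc k))
  open ≡-Reasoning
  cancels : inside L (x , y - 1ℤ) ℙ.+ inside L (x , y) ≡ 0ℙ
  cancels = begin
    inside L (x , y - 1ℤ) ℙ.+ inside L (x , y)
      ≡⟨ cong₂ ℙ._+_ (parity-sum-upTo _ (n L)) (parity-sum-upTo _ (n L)) ⟩
    Σℙ (crossing (y - 1ℤ)) (n L) ℙ.+ Σℙ (crossing y) (n L)
      ≡⟨ Σℙ-telescoping {F = mark} step (n L) ⟩
    mark 0 ℙ.+ mark (n L) ≡⟨ cong (λ p → mark 0 ℙ.+ rowMark x y p) (periodic L 0ℤ) ⟩
    mark 0 ℙ.+ mark 0     ≡⟨ ℙₚ.p+p≡0ℙ (mark 0) ⟩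
    0ℙ                    ∎

inside-across-non-edge : ∀ L {s} → ¬ IsEdge L s → inside L (cell⁻ s) ≡ inside L (cell⁺ s)
inside-across-non-edge L {vert _ _}  ¬e = cong parity (crossCount-across-vert L ¬e)
inside-across-non-edge L {horiz _ _} ¬e = inside-across-horiz L ¬e

Obeys : Loop → (Parity → Parity) → Point → Set
Obeys L f C = inside L C ≡ f (colour C)

SidesObey : Loop → (Parity → Parity) → Segment → Set
SidesObey L f s = Obeys L f (cell⁻ s) × Obeys L f (cell⁺ s)

obeys-transfer : ∀ {L f} C C' → inside L C ≡ inside L C' → colour C ≡ colour C' →
                 Obeys L f C ⇔ Obeys L f C'
obeys-transfer {f = f} _ _ i c =
  mk⇔ (λ o → trans (sym i) (trans o (cong f c))) (λ o → trans i (trans o (cong f (sym c))))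

some-rule-fits : ∀ L s → ∃[ f ] SidesObey L f s
some-rule-fits L s with interpolate (colour (cell⁺ s)) (inside L (cell⁺ s)) (inside L (cell⁻ s))
... | f , f⁺ , f⁻ = f , trans (sym f⁻) (cong f (sym (colour-cell⁻ s))) , sym f⁺

-- Hitomezashi loops

module Hitomezashi (L : Loop) (ε η : ℤ → Fin 2)
                   (stitches : ∀ k → IsStitch ε η (v L k) (v L (k + 1ℤ))) where

  Stitched : Segment → Set
  Stitched (vert i j)  = PatV ε i j
  Stitched (horiz i j) = PatH η i j

  edge-stitched : ∀ {s} → IsEdge L s → Stitched s
  edge-stitched (k , J) with stitches k
  ... | inj₁ (i , j , J' , pat) = subst Stitched (joins-unique {vert i j} J' J) pat
  ... | inj₂ (i , j , J' , pat) = subst Stitched (joins-unique {horiz i j} J' J) pat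

  inside-across-unstitched : ∀ s → ¬ Stitched s → inside L (cell⁻ s) ≡ inside L (cell⁺ s)
  inside-across-unstitched s ¬st = inside-across-non-edge L {s} (¬st ∘ edge-stitched {s})

  opposite : ∀ {a} → Dir a → Dir a
  opposite up    = down
  opposite down  = up
  opposite left  = right
  opposite right = left

  inside-across-opposite : ∀ {a} c (d : Dir a) → Stitched (segmentAt c d) →
    let s = segmentAt c (opposite d) in inside L (cell⁻ s) ≡ inside L (cell⁺ s)
  inside-across-opposite (x , y) up su =
    inside-across-unstitched (vert x (y - 1ℤ)) (%ℕ2-alternates {y} su)
  inside-across-opposite (x , y) down sd =
    inside-across-unstitched (vert x y) (λ su → %ℕ2-alternates {y} su sd)
  inside-across-opposite (x , y) left sl =
    inside-across-unstitched (horiz x y) (λ sr → %ℕ2-alternates {x} sr sl)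
  inside-across-opposite (x , y) right sr =
    inside-across-unstitched (horiz (x - 1ℤ) y) (%ℕ2-alternates {x} sr)

  stitched-direction-unique : ∀ {a c} (d d' : Dir a) →
                              Stitched (segmentAt c d) → Stitched (segmentAt c d') → d ≡ d'
  stitched-direction-unique up    up    _  _  = refl
  stitched-direction-unique down  down  _  _  = refl
  stitched-direction-unique left  left  _  _  = refl
  stitched-direction-unique right right _  _  = refl
  stitched-direction-unique {c = _ , y} up    down  su sd = ⊥-elim (%ℕ2-alternates {y} su sd)
  stitched-direction-unique {c = _ , y} down  up    sd su = ⊥-elim (%ℕ2-alternates {y} su sd)
  stitched-direction-unique {c = x , _} left  right sl sr = ⊥-elim (%ℕ2-alternates {x} sr sl)
  stitched-direction-unique {c = x , _} right left  sr sl = ⊥-elim (%ℕ2-alternates {x} sr sl)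

  -- The cell between the two stitches at a corner lies beside both of them; the other two cells
  -- beside them are linked through the opposite corner cell by the two unstitched segments.
  obeys-corner : ∀ f {x y} (dv : Dir vertical) (dh : Dir horizontal) →
    Stitched (segmentAt (x , y) dv) → Stitched (segmentAt (x , y) dh) →
    SidesObey L f (segmentAt (x , y) dv) ⇔ SidesObey L f (segmentAt (x , y) dh)
  obeys-corner f {x} {y} up right su sr = mk⇔ (Prod.map₁ (to nw⇔se)) (Prod.map₁ (from nw⇔se))
    where
    nw⇔se : Obeys L f (x - 1ℤ , y) ⇔ Obeys L f (x , y - 1ℤ)
    nw⇔se = obeys-transfer {L} {f} (x - 1ℤ , y) (x , y - 1ℤ)
      (trans (sym (inside-across-opposite (x , y) right sr)) (inside-across-opposite (x , y) up su))
      (colour-antidiagonal x y)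
  obeys-corner f {x} {y} up left su sl =
    mk⇔ (λ (nw , ne) → to ne⇔sw ne , nw) (λ (sw , nw) → nw , from ne⇔sw sw)
    where
    ne⇔sw : Obeys L f (x , y) ⇔ Obeys L f (x - 1ℤ , y - 1ℤ)
    ne⇔sw = obeys-transfer {L} {f} (x , y) (x - 1ℤ , y - 1ℤ)
      (sym (trans (inside-across-opposite (x , y) up su) (inside-across-opposite (x , y) left sl)))
      (sym (colour-diagonal x y))
  obeys-corner f {x} {y} down right sd sr =
    mk⇔ (λ (sw , se) → se , to sw⇔ne sw) (λ (se , ne) → from sw⇔ne ne , se)
    where
    sw⇔ne : Obeys L f (x - 1ℤ , y - 1ℤ) ⇔ Obeys L f (x , y)
    sw⇔ne = obeys-transfer {L} {f} (x - 1ℤ , y - 1ℤ) (x , y)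
      (trans (inside-across-opposite (x , y) right sr) (inside-across-opposite (x , y) down sd))
      (colour-diagonal x y)
  obeys-corner f {x} {y} down left sd sl = mk⇔ (Prod.map₂ (to se⇔nw)) (Prod.map₂ (from se⇔nw))
    where
    se⇔nw : Obeys L f (x , y - 1ℤ) ⇔ Obeys L f (x - 1ℤ , y)
    se⇔nw = obeys-transfer {L} {f} (x , y - 1ℤ) (x - 1ℤ , y)
      (trans (inside-across-opposite (x , y) left sl)
             (sym (inside-across-opposite (x , y) down sd)))
      (sym (colour-antidiagonal x y))

  data Corner (c : Point) : Segment → Segment → Set where
    vh : (dv : Dir vertical) (dh : Dir horizontal) →
         Stitched (segmentAt c dv) → Stitched (segmentAt c dh) →
         Corner c (segmentAt c dv) (segmentAt c dh)
    hv : (dv : Dir vertical) (dh : Dir horizontal) →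
         Stitched (segmentAt c dv) → Stitched (segmentAt c dh) →
         Corner c (segmentAt c dh) (segmentAt c dv)

  obeys-across-corner : ∀ f {c s s'} → Corner c s s' → SidesObey L f s ⇔ SidesObey L f s'
  obeys-across-corner f (vh dv dh sv sh) = obeys-corner f dv dh sv sh
  obeys-across-corner f (hv dv dh sv sh) = ⇔.sym (obeys-corner f dv dh sv sh)

  EdgeFrom : Point → Axis → Set
  EdgeFrom c a = Σ[ d ∈ Dir a ] IsEdge L (segmentAt c d)

  corner-edge : ∀ {c s s'} → Corner c s s' → IsEdge L s → IsEdge L s' → ∀ a → EdgeFrom c a
  corner-edge (vh dv _ _ _) e _ vertical   = dv , e
  corner-edge (vh _ dh _ _) _ e horizontal = dh , e
  corner-edge (hv dv _ _ _) _ e vertical   = dv , e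
  corner-edge (hv _ dh _ _) e _ horizontal = dh , e

  edge-stitched-at : ∀ k {s} → edge L k ≡ s → Stitched s
  edge-stitched-at k e = subst Stitched e (edge-stitched (k , edge-joins L k))

  same-axis-impossible : ∀ k {a c} (d d' : Dir a) →
    edge L k ≡ segmentAt c d → v L k ≡ neighbour c d →
    edge L (k + 1ℤ) ≡ segmentAt c d' → v L (k + 1ℤ + 1ℤ) ≡ neighbour c d' → ⊥
  same-axis-impossible k d d' e n e' n' =
    no-backtrack L k (trans n (trans (cong (neighbour _) d≡d') (sym n')))
    where
    d≡d' : d ≡ d'
    d≡d' = stitched-direction-unique d d' (edge-stitched-at k e) (edge-stitched-at (k + 1ℤ) e')

  corner-at-vertex : ∀ k → Corner (v L (k + 1ℤ)) (edge L k) (edge L (k + 1ℤ))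
  corner-at-vertex k
    with joins⇒segmentAt {edge L k} (edge-joins L k)
       | joins⇒segmentAt {edge L (k + 1ℤ)} (joins-sym {edge L (k + 1ℤ)} (edge-joins L (k + 1ℤ)))
  ... | vertical , d , e , n | vertical , d' , e' , n' =
    ⊥-elim (same-axis-impossible k d d' e n e' n')
  ... | horizontal , d , e , n | horizontal , d' , e' , n' =
    ⊥-elim (same-axis-impossible k d d' e n e' n')
  ... | vertical , dv , e , _ | horizontal , dh , e' , _ = subst₂ (Corner _) (sym e) (sym e')
    (vh dv dh (edge-stitched-at k e) (edge-stitched-at (k + 1ℤ) e'))
  ... | horizontal , dh , e , _ | vertical , dv , e' , _ = subst₂ (Corner _) (sym e) (sym e')
    (hv dv dh (edge-stitched-at (k + 1ℤ) e') (edge-stitched-at k e))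

  colourRule : Parity → Parity
  colourRule = proj₁ (some-rule-fits L (edge L 0ℤ))

  edges-obey : ∀ {s} → IsEdge L s → SidesObey L colourRule s
  edges-obey {s} (k , J) =
    subst (SidesObey L colourRule) (joins-unique {edge L k} {s} (edge-joins L k) J) (all-edges k)
    where
    all-edges : ∀ k → SidesObey L colourRule (edge L k)
    all-edges = ℤ-induction (SidesObey L colourRule ∘ edge L)
                            (obeys-across-corner colourRule ∘ corner-at-vertex)
                            (proj₂ (some-rule-fits L (edge L 0ℤ)))

  edge-from-vertex : ∀ k a → EdgeFrom (v L k) a
  edge-from-vertex k = subst (λ c → ∀ a → EdgeFrom c a) (cong (v L) (-1+1 k))
    (corner-edge (corner-at-vertex (k - 1ℤ)) (_ , edge-joins L _) (_ , edge-joins L _))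

  vertical-edge-at-vertex : ∀ k {x y} → v L k ≡ (x , y) → ∃[ j ] Near y j × VStitch L x j
  vertical-edge-at-vertex k eq
    with subst (λ c → EdgeFrom c vertical) eq (edge-from-vertex k vertical)
  ... | up   , e = _ , inj₁ refl , e
  ... | down , e = _ , inj₂ refl , e

  horizontal-edge-at-vertex : ∀ k {x y} → v L k ≡ (x , y) → ∃[ i ] Near x i × HStitch L i y
  horizontal-edge-at-vertex k eq
    with subst (λ c → EdgeFrom c horizontal) eq (edge-from-vertex k horizontal)
  ... | right , e = _ , inj₁ refl , e
  ... | left  , e = _ , inj₂ refl , e

  left-wall : ∀ {a b} → HStitch L a b → ∃[ j ] Near b j × VStitch L a j
  left-wall (k , inj₁ (p , _)) = vertical-edge-at-vertex k p
  left-wall (k , inj₂ (_ , q)) = vertical-edge-at-vertex (k + 1ℤ) q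

  right-wall : ∀ {a b} → HStitch L a b → ∃[ j ] Near b j × VStitch L (a + 1ℤ) j
  right-wall (k , inj₁ (_ , q)) = vertical-edge-at-vertex (k + 1ℤ) q
  right-wall (k , inj₂ (p , _)) = vertical-edge-at-vertex k p

  lower-wall : ∀ {a b} → VStitch L a b → ∃[ i ] Near a i × HStitch L i b
  lower-wall (k , inj₁ (p , _)) = horizontal-edge-at-vertex k p
  lower-wall (k , inj₂ (_ , q)) = horizontal-edge-at-vertex (k + 1ℤ) q

  upper-wall : ∀ {a b} → VStitch L a b → ∃[ i ] Near a i × HStitch L i (b + 1ℤ)
  upper-wall (k , inj₁ (_ , q)) = horizontal-edge-at-vertex (k + 1ℤ) q
  upper-wall (k , inj₂ (p , _)) = horizontal-edge-at-vertex k p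

  vstitch-parity : ∀ {i j} → VStitch L i j → parityℤ j ≡ parity (toℕ (ε i))
  vstitch-parity {i} {j} e = trans (sym (parity-%ℕ2 j)) (cong parity (edge-stitched {vert i j} e))

  hstitch-parity : ∀ {i j} → HStitch L i j → parityℤ i ≡ parity (toℕ (η j))
  hstitch-parity {i} {j} e = trans (sym (parity-%ℕ2 i)) (cong parity (edge-stitched {horiz i j} e))

  interior-right-of-vert : ∀ {a j} → VStitch L a j →
    InteriorCell L a j ⇔ colourRule (parityℤ a ℙ.+ parity (toℕ (ε a))) ≡ 1ℙ
  interior-right-of-vert {a} {j} e = subst (λ p → InteriorCell L a j ⇔ p ≡ 1ℙ)
    (trans (proj₂ (edges-obey {vert a j} e))
           (cong (λ p → colourRule (parityℤ a ℙ.+ p)) (vstitch-parity e)))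
    (interior⇔inside≡1ℙ L {a} {j})

  interior-above-horiz : ∀ {i b} → HStitch L i b →
    InteriorCell L i b ⇔ colourRule (parity (toℕ (η b)) ℙ.+ parityℤ b) ≡ 1ℙ
  interior-above-horiz {i} {b} e = subst (λ p → InteriorCell L i b ⇔ p ≡ 1ℙ)
    (trans (proj₂ (edges-obey {horiz i b} e))
           (cong (λ p → colourRule (p ℙ.+ parityℤ b)) (hstitch-parity e)))
    (interior⇔inside≡1ℙ L {i} {b})

-- W₁ and W₂ play the roles of the paper's s₁ and s₂; indents and outdents are the dents
-- Dent (¬_ ∘ Inside) and Dent Inside.
module Dents {Stitch W₁ W₂ : ℤ → Set} {e₁ e₂ : Parity}
  (wall₁ : ∀ {t} → Stitch t → ∃[ j ] Near t j × W₁ j)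
  (wall₂ : ∀ {t} → Stitch t → ∃[ j ] Near t j × W₂ j)
  (parity₁ : ∀ {j} → W₁ j → parityℤ j ≡ e₁)
  (parity₂ : ∀ {j} → W₂ j → parityℤ j ≡ e₂)
  where

  Dent : (ℤ → Set) → ℤ → Set
  Dent P t = ∃[ j ] Near t j × W₁ j × W₂ j × P j

  Nondent : ℤ → Set
  Nondent t = ∃[ j₁ ] ∃[ j₂ ] Near t j₁ × Near t j₂ × W₁ j₁ × W₂ j₂ × ¬ j₁ ≡ j₂

  misaligned : e₁ ≢ e₂ → ∀ {t} → Stitch t → Nondent t
  misaligned e₁≢e₂ st with wall₁ st | wall₂ st
  ... | j₁ , n₁ , w₁ | j₂ , n₂ , w₂ =
    j₁ , j₂ , n₁ , n₂ , w₁ , w₂ , λ { refl → e₁≢e₂ (trans (sym (parity₁ w₁)) (parity₂ w₂)) }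

  aligned : e₁ ≡ e₂ → ∀ {t} → Stitch t → ∃[ j ] Near t j × W₁ j × W₂ j
  aligned e₁≡e₂ st with wall₁ st | wall₂ st
  ... | j₁ , n₁ , w₁ | j₂ , n₂ , w₂ = j₁ , n₁ , w₁ , subst W₂ (sym j₁≡j₂) w₂
    where
    j₁≡j₂ : j₁ ≡ j₂
    j₁≡j₂ = near-parityℤ-injective n₁ n₂
              (trans (parity₁ w₁) (trans e₁≡e₂ (sym (parity₂ w₂))))

  aligned-dents : ∀ {Inside : ℤ → Set} c → (∀ {j} → W₁ j → Inside j ⇔ c ≡ 1ℙ) →
                  (∀ {t} → Stitch t → ∃[ j ] Near t j × W₁ j × W₂ j) →
                  (∀ t → Stitch t → Dent (¬_ ∘ Inside) t) ⊎ (∀ t → Stitch t → Dent Inside t)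
  aligned-dents 0ℙ status walls = inj₁ λ _ st → let (j , n , w₁ , w₂) = walls st in
    j , n , w₁ , w₂ , λ interior → case to (status w₁) interior of λ ()
  aligned-dents 1ℙ status walls = inj₂ λ _ st → let (j , n , w₁ , w₂) = walls st in
    j , n , w₁ , w₂ , from (status w₁) refl

  trichotomy : ∀ {Inside : ℤ → Set} {c} → (∀ {j} → W₁ j → Inside j ⇔ c ≡ 1ℙ) →
    (∀ t → Stitch t → Dent (¬_ ∘ Inside) t) ⊎ (∀ t → Stitch t → Dent Inside t) ⊎
    (∀ t → Stitch t → Nondent t)
  trichotomy {c = c} status with e₁ ℙₚ.≟ e₂
  ... | yes e₁≡e₂ = Sum.assocʳ (inj₁ (aligned-dents c status (aligned e₁≡e₂)))
  ... | no e₁≢e₂  = inj₂ (inj₂ λ _ → misaligned e₁≢e₂)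

corollary2p6 : (L : Loop) → IsHitomezashiLoop L →
    (∀ (a : ℤ) → ∃[ b ] HStitch L a b →
        (∀ b → HStitch L a b → HIndent L a b)
      ⊎ (∀ b → HStitch L a b → HOutdent L a b)
      ⊎ (∀ b → HStitch L a b → HNondent L a b))
    ×
    (∀ (b : ℤ) → ∃[ a ] VStitch L a b →
        (∀ a → VStitch L a b → VIndent L a b)
      ⊎ (∀ a → VStitch L a b → VOutdent L a b)
      ⊎ (∀ a → VStitch L a b → VNondent L a b))
corollary2p6 L (ε , η , stitches) =
  (λ a _ → Dents.trichotomy left-wall right-wall vstitch-parity vstitch-parity
                            interior-right-of-vert) ,
  (λ b _ → Dents.trichotomy lower-wall upper-wall hstitch-parity hstitch-parity
                            interior-above-horiz)
  where open Hitomezashi L ε η stitches
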